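{- Let $M$ be a simple matroid on a finite ground set $E$ with closure operator $\operatorname{cl}$ and set of circuits $\mathcal{C}$. If $C \in \mathcal{C}$ satisfies $\operatorname{cl}(C) = C$, then $C \in \mathcal{C}'$ for every tropical basis $\mathcal{C}'$ of $M$.
   Context: A subset $\mathcal{C}' \subseteq \mathcal{C}$ of the circuits of $M$ is a tropical basis of $M$ if for every set $X \subseteq E$ with $X \neq \operatorname{cl}(X)$ there exists $C \in \mathcal{C}'$ with $|C \setminus X| = 1$. -}

module Defs where

open import Data.Nat using (ℕ; _≤_; _+_; _≟_)
open import Data.Bool using (Bool)
open import Data.Fin using (Fin)
open import Data.Fin.Subset using (Subset; _∈_; _⊆_; _⊂_; _∪_; _∩_; _─_; ⁅_⁆; ∣_∣)
open import Data.Vec using (tabulate)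
open import Data.Product using (_×_; ∃-syntax)
open import Relation.Binary.PropositionalEquality using (_≡_; _≢_)
open import Relation.Nullary using (¬_; does)

record Matroid (n : ℕ) : Set where
  field
    rank        : Subset n → ℕ
    rank-bound  : ∀ X → rank X ≤ ∣ X ∣
    rank-mono   : ∀ {X Y} → X ⊆ Y → rank X ≤ rank Y
    rank-submod : ∀ X Y → rank (X ∪ Y) + rank (X ∩ Y) ≤ rank X + rank Y

module _ {n : ℕ} (M : Matroid n) where
  open Matroid M

  Independent : Subset n → Set
  Independent X = rank X ≡ ∣ X ∣

  Dependent : Subset n → Set
  Dependent X = ¬ Independent X

  IsCircuit : Subset n → Set
  IsCircuit C = Dependent C × (∀ D → D ⊂ C → Independent D)

  cl : Subset n → Subset n
  cl X = tabulate (λ e → does (rank (X ∪ ⁅ e ⁆) ≟ rank X))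

  -- simple: no loops and no parallel elements, i.e. every circuit has at least 3 elements
  Simple : Set
  Simple = ∀ C → IsCircuit C → 3 ≤ ∣ C ∣

  IsTropicalBasis : (Subset n → Set) → Set
  IsTropicalBasis C' =
    (∀ C → C' C → IsCircuit C) ×
    (∀ X → X ≢ cl X → ∃[ C ] (C' C × ∣ C ─ X ∣ ≡ 1))

-- Pick e ∈ C. Since a circuit lies in the closure of any of its one-element
-- deletions, e ∈ cl (C - e) ∖ (C - e), so the tropical basis supplies D ∈ C'
-- with |D ∖ (C - e)| = 1. Then D has at most one element outside the flat C,
-- and a flat containing all but one element of a circuit contains the whole
-- circuit. Hence D ⊆ C, and minimality of circuits forces D = C.
{-# OPTIONS --safe #-}
module Submission where

open import Defs
open import Data.Nat using (ℕ; suc; _≤_; _+_; _≟_; s≤s; s≤s⁻¹)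
open import Data.Nat.Properties
  using (≤-antisym; ≤-trans; +-cancelʳ-≤; +-mono-≤; ≤∧≢⇒<; n≤0⇒n≡0; module ≤-Reasoning)
open import Data.Bool using (true; false)
import Data.Fin.Properties as Fin
open import Data.Fin.Subset
open import Data.Fin.Subset.Properties
open import Data.Vec using (_∷_; here; there)
open import Data.Vec.Properties using (lookup⇒[]=; []=⇒lookup; lookup∘tabulate)
open import Data.Product using (_,_; proj₁)
open import Data.Sum using (inj₁; inj₂)
open import Function using (_∘_)
open import Relation.Nullary using (Dec; yes; no; does; contradiction)
open import Relation.Nullary.Decidable using (dec-true)
open import Relation.Binary.PropositionalEquality

does≡true⇒ : ∀ {a} {A : Set a} (a? : Dec A) → does a? ≡ true → A
does≡true⇒ (yes a) _ = a

suc∣p-x∣≡∣p∣ : ∀ {n} {p : Subset n} {x} → x ∈ p → suc ∣ p - x ∣ ≡ ∣ p ∣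
suc∣p-x∣≡∣p∣ {p = true ∷ p}  here        = cong (suc ∘ ∣_∣) (p─⊥≡p p)
suc∣p-x∣≡∣p∣ {p = true ∷ p}  (there x∈p) = cong suc (suc∣p-x∣≡∣p∣ x∈p)
suc∣p-x∣≡∣p∣ {p = false ∷ p} (there x∈p) = suc∣p-x∣≡∣p∣ x∈p

x∈p─q⇒x∉q : ∀ {n} {p q : Subset n} {x} → x ∈ p ─ q → x ∉ q
x∈p─q⇒x∉q {p = _ ∷ _} {true ∷ _}  (there x∈p─q) (there x∈q) = x∈p─q⇒x∉q x∈p─q x∈q
x∈p─q⇒x∉q {p = _ ∷ _} {false ∷ _} (there x∈p─q) (there x∈q) = x∈p─q⇒x∉q x∈p─q x∈q

p-x∪⁅x⁆⊆p : ∀ {n} {p : Subset n} {x} → x ∈ p → (p - x) ∪ ⁅ x ⁆ ⊆ p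
p-x∪⁅x⁆⊆p {p = p} {x} x∈p y∈ with x∈p∪q⁻ (p - x) ⁅ x ⁆ y∈
... | inj₁ y∈p-x = p─q⊆p p ⁅ x ⁆ y∈p-x
... | inj₂ y∈⁅x⁆ = subst (_∈ p) (sym (x∈⁅y⁆⇒x≡y x y∈⁅x⁆)) x∈p

─-antitoneʳ : ∀ {n} (p : Subset n) {q r} → q ⊆ r → p ─ r ⊆ p ─ q
─-antitoneʳ p {r = r} q⊆r x∈p─r =
  x∈p∧x∉q⇒x∈p─q (p─q⊆p p r x∈p─r) (x∈p─q⇒x∉q x∈p─r ∘ q⊆r)

∣p∣≤1⇒x≡y : ∀ {n} {p : Subset n} {x y} → ∣ p ∣ ≤ 1 → x ∈ p → y ∈ p → x ≡ y
∣p∣≤1⇒x≡y {p = p} {x} {y} ∣p∣≤1 x∈p y∈p with x Fin.≟ y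
... | yes x≡y = x≡y
... | no x≢y = contradiction (≤-trans 2≤∣p∣ ∣p∣≤1) λ { (s≤s ()) }
  where
  1≤∣p-x∣ : 1 ≤ ∣ p - x ∣
  1≤∣p-x∣ = subst (_≤ ∣ p - x ∣) (∣⁅x⁆∣≡1 y)
    (p⊆q⇒∣p∣≤∣q∣ λ z∈⁅y⁆ → subst (_∈ p - x) (sym (x∈⁅y⁆⇒x≡y y z∈⁅y⁆))
      (x∈p∧x≢y⇒x∈p-y y∈p (x≢y ∘ sym)))
  2≤∣p∣ : 2 ≤ ∣ p ∣
  2≤∣p∣ = ≤-trans (s≤s 1≤∣p-x∣) (x∈p⇒∣p-x∣<∣p∣ x∈p)

∣p─q∣≤1⇒p-x⊆q : ∀ {n} {p q : Subset n} {x} → ∣ p ─ q ∣ ≤ 1 → x ∈ p → x ∉ q → p - x ⊆ q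
∣p─q∣≤1⇒p-x⊆q {p = p} {q} {x} ∣p─q∣≤1 x∈p x∉q {y} y∈p-x with y ∈? q
... | yes y∈q = y∈q
... | no y∉q = contradiction
  (∣p∣≤1⇒x≡y ∣p─q∣≤1 (x∈p∧x∉q⇒x∈p─q (p─q⊆p p ⁅ x ⁆ y∈p-x) y∉q) (x∈p∧x∉q⇒x∈p─q x∈p x∉q))
  (x∉⁅y⁆⇒x≢y (x∈p─q⇒x∉q y∈p-x))

module _ {n : ℕ} (M : Matroid n) where
  open Matroid M

  ∈cl⁺ : ∀ {X e} → rank (X ∪ ⁅ e ⁆) ≤ rank X → e ∈ cl M X
  ∈cl⁺ {X} {e} r≤r = lookup⇒[]= e (cl M X)
    (trans (lookup∘tabulate _ e) (dec-true (rank (X ∪ ⁅ e ⁆) ≟ rank X) r≡r))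
    where
    r≡r : rank (X ∪ ⁅ e ⁆) ≡ rank X
    r≡r = ≤-antisym r≤r (rank-mono (p⊆p∪q ⁅ e ⁆))

  ∈cl⁻ : ∀ {X e} → e ∈ cl M X → rank (X ∪ ⁅ e ⁆) ≡ rank X
  ∈cl⁻ {X} {e} e∈clX = does≡true⇒ (rank (X ∪ ⁅ e ⁆) ≟ rank X)
    (trans (sym (lookup∘tabulate _ e)) ([]=⇒lookup e∈clX))

  cl-mono : ∀ {X Y} → X ⊆ Y → cl M X ⊆ cl M Y
  cl-mono {X} {Y} X⊆Y {f} f∈clX = ∈cl⁺ (+-cancelʳ-≤ (rank X) _ _ (begin
    rank (Y ∪ ⁅ f ⁆) + rank X                        ≤⟨ +-mono-≤ (rank-mono Y∪f⊆) (rank-mono X⊆) ⟩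
    rank (Y ∪ (X ∪ ⁅ f ⁆)) + rank (Y ∩ (X ∪ ⁅ f ⁆))  ≤⟨ rank-submod Y (X ∪ ⁅ f ⁆) ⟩
    rank Y + rank (X ∪ ⁅ f ⁆)                        ≡⟨ cong (rank Y +_) (∈cl⁻ f∈clX) ⟩
    rank Y + rank X                                  ∎))
    where
    open ≤-Reasoning
    Y∪f⊆ : Y ∪ ⁅ f ⁆ ⊆ Y ∪ (X ∪ ⁅ f ⁆)
    Y∪f⊆ x∈ with x∈p∪q⁻ Y ⁅ f ⁆ x∈
    ... | inj₁ x∈Y = x∈p∪q⁺ (inj₁ x∈Y)
    ... | inj₂ x∈f = x∈p∪q⁺ (inj₂ (x∈p∪q⁺ (inj₂ x∈f)))
    X⊆ : X ⊆ Y ∩ (X ∪ ⁅ f ⁆)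
    X⊆ x∈X = x∈p∩q⁺ (X⊆Y x∈X , x∈p∪q⁺ (inj₁ x∈X))

  dependent⇒nonempty : ∀ {X} → Dependent M X → Nonempty X
  dependent⇒nonempty {X} X-dep with nonempty? X
  ... | yes X-nonempty = X-nonempty
  ... | no X-empty = contradiction (trans (n≤0⇒n≡0 (subst (rank X ≤_) ∣X∣≡0 (rank-bound X))) (sym ∣X∣≡0)) X-dep
    where
    ∣X∣≡0 : ∣ X ∣ ≡ 0
    ∣X∣≡0 = trans (cong ∣_∣ (Empty-unique X-empty)) (∣⊥∣≡0 n)

  x∈cl[C-x] : ∀ {C x} → IsCircuit M C → x ∈ C → x ∈ cl M (C - x)
  x∈cl[C-x] {C} {x} (C-dep , C-minimal) x∈C = ∈cl⁺ (begin
    rank ((C - x) ∪ ⁅ x ⁆)  ≤⟨ rank-mono (p-x∪⁅x⁆⊆p x∈C) ⟩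
    rank C                  ≤⟨ s≤s⁻¹ (subst (suc (rank C) ≤_) (sym (suc∣p-x∣≡∣p∣ x∈C)) rank<∣C∣) ⟩
    ∣ C - x ∣               ≡⟨ sym (C-minimal (C - x) (x∈p⇒p-x⊂p x∈C)) ⟩
    rank (C - x)            ∎)
    where
    open ≤-Reasoning
    rank<∣C∣ : suc (rank C) ≤ ∣ C ∣
    rank<∣C∣ = ≤∧≢⇒< (rank-bound C) C-dep

  C-x≢cl[C-x] : ∀ {C x} → IsCircuit M C → x ∈ C → C - x ≢ cl M (C - x)
  C-x≢cl[C-x] {C} {x} C-circuit x∈C C-x≡cl =
    x∈p─q⇒x∉q (subst (x ∈_) (sym C-x≡cl) (x∈cl[C-x] C-circuit x∈C)) (x∈⁅x⁆ x)

  circuit⊆flat : ∀ {F D} → cl M F ≡ F → IsCircuit M D → ∣ D ─ F ∣ ≤ 1 → D ⊆ F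
  circuit⊆flat {F} {D} clF≡F D-circuit ∣D─F∣≤1 {x} x∈D with x ∈? F
  ... | yes x∈F = x∈F
  ... | no x∉F = subst (x ∈_) clF≡F
    (cl-mono (∣p─q∣≤1⇒p-x⊆q ∣D─F∣≤1 x∈D x∉F) (x∈cl[C-x] D-circuit x∈D))

  circuit⊆circuit⇒≡ : ∀ {C D} → IsCircuit M C → IsCircuit M D → D ⊆ C → D ≡ C
  circuit⊆circuit⇒≡ {C} {D} (_ , C-minimal) (D-dep , _) D⊆C = ⊆-antisym D⊆C C⊆D
    where
    C⊆D : C ⊆ D
    C⊆D {x} x∈C with x ∈? D
    ... | yes x∈D = x∈D
    ... | no x∉D = contradiction (C-minimal D (D⊆C , x , x∈C , x∉D)) D-dep

-- The simplicity hypothesis is unused: the argument works in every matroid.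
proposition2 : ∀ {n : ℕ} (M : Matroid n) → Simple M →
    ∀ (C : Subset n) → IsCircuit M C → cl M C ≡ C →
    ∀ (C' : Subset n → Set) → IsTropicalBasis M C' → C' C
proposition2 M _ C C-circuit clC≡C C' (C'⊆circuits , tropical)
  with dependent⇒nonempty M (proj₁ C-circuit)
... | e , e∈C with tropical (C - e) (C-x≢cl[C-x] M C-circuit e∈C)
... | D , D∈C' , ∣D─[C-e]∣≡1 = subst C' D≡C D∈C'
  where
  D-circuit : IsCircuit M D
  D-circuit = C'⊆circuits D D∈C'
  ∣D─C∣≤1 : ∣ D ─ C ∣ ≤ 1
  ∣D─C∣≤1 = subst (∣ D ─ C ∣ ≤_) ∣D─[C-e]∣≡1 (p⊆q⇒∣p∣≤∣q∣ (─-antitoneʳ D (p─q⊆p C ⁅ e ⁆)))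
  D≡C : D ≡ C
  D≡C = circuit⊆circuit⇒≡ M C-circuit D-circuit (circuit⊆flat M clC≡C D-circuit ∣D─C∣≤1)
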